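{- Let $k$ be a positive integer and let $\Phi$ be a systematic $(m,2k,s,2)$-scheme (i.e. it stores sets of size up to $2k$). Then no pseudo-graph $G_\Phi$ associated with $\Phi$ has two edge-disjoint cycles, each of length at most $k$, that have a vertex in common.
   Context: An $(m,n,s,2)$-scheme consists of a map $\phi$ assigning to each $S\subseteq[m]$ with $|S|\le n$ an $s$-bit string and, for each $x\in[m]$, a decision tree of depth at most $2$ probing bits of the string, such that the tree for $x$ outputs Yes on $\phi(S)$ iff $x\in S$. It is systematic if each tree outputs the last bit it reads ($1$ = Yes). For such a scheme $\Phi$, each query for $x$ first probes a location $c(x)\in[s]$, and then probes location $j(x)$ if the first bit is $0$ and location $k(x)$ if it is $1$. The bipartite multigraph $H_\Phi$ has vertex sets $A_0=\{A_0[1],\dots,A_0[s]\}$ and $A_1=\{A_1[1],\dots,A_1[s]\}$, and for each $x\in[m]$ an edge $\{A_0[j(x)],A_1[k(x)]\}$ with label $x$ and colour $c(x)$. A pseudo-graph $G_\Phi$ has the same vertices; its edges are obtained as follows: for each colour $\alpha$, the edges of $H_\Phi$ of colour $\alpha$ are partitioned into ordered pairs (omitting one edge if their number is odd), and for each pair $(e,e')$ with $e=\{u,v\}$ labelled $x$, $e'=\{u',v'\}$ labelled $x'$, $u,u'\in A_0$, $v,v'\in A_1$, the edge $\{u,v'\}$ with label $\{(u,x),(v',x')\}$ is included in $G_\Phi$. -}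

module Defs where

open import Data.Nat using (ℕ; suc; _≤_)
open import Data.Bool using (Bool; true; false; if_then_else_)
open import Data.Fin using (Fin; zero; suc; inject₁; fromℕ)
open import Data.Fin.Subset using (Subset; _∈_; ∣_∣)
open import Data.List using (List; []; _∷_; concatMap; length; lookup)
open import Data.List.Relation.Unary.Unique.Propositional using (Unique)
import Data.List.Membership.Propositional as LM
open import Data.Product using (Σ; _×_; _,_; proj₁; proj₂)
open import Data.Sum using (_⊎_; inj₁; inj₂)
open import Relation.Binary.PropositionalEquality using (_≡_)
open import Relation.Nullary using (¬_)
open import Function.Definitions using (Injective)

-- Each query for x probes c x; if the bit
-- read is 0 it probes j x, if it is 1 it probes k x, and outputs the last
-- bit read (true = Yes).  (A depth-1 tree is the case j x = k x = c x.)
record SystematicScheme (m n s : ℕ) : Set where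
  field
    c  : Fin m → Fin s
    j  : Fin m → Fin s
    k  : Fin m → Fin s
    φ  : (S : Subset m) → ∣ S ∣ ≤ n → (Fin s → Bool)

  query : Fin m → (Fin s → Bool) → Bool
  query x t = if t (c x) then t (k x) else t (j x)

  field
    correct : (S : Subset m) (h : ∣ S ∣ ≤ n) (x : Fin m) →
              (query x (φ S h) ≡ true → x ∈ S) × (x ∈ S → query x (φ S h) ≡ true)

flatten : {m : ℕ} → List (Fin m × Fin m) → List (Fin m)
flatten = concatMap (λ p → proj₁ p ∷ proj₂ p ∷ [])

-- A colour-wise partition of the edges of H_Φ (identified with their labels
-- x ∈ [m]) into ordered pairs (x , x') of the same colour, each label used at
-- most once, and for each colour at most one label left over.
record Pairing {m n s : ℕ} (Φ : SystematicScheme m n s) : Set where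
  open SystematicScheme Φ
  field
    pairs     : List (Fin m × Fin m)
    sameColour : ∀ {x x'} → (x , x') LM.∈ pairs → c x ≡ c x'
    disjoint  : Unique (flatten pairs)
    leftover  : ∀ x y → ¬ (x LM.∈ flatten pairs) → ¬ (y LM.∈ flatten pairs) →
                c x ≡ c y → x ≡ y

-- Vertices A_0[i] = inj₁ i , A_1[i] = inj₂ i.
Vertex : ℕ → Set
Vertex s = Fin s ⊎ Fin s

module _ {m n s : ℕ} {Φ : SystematicScheme m n s} (P : Pairing Φ) where
  open SystematicScheme Φ
  open Pairing P

  Edge : Set
  Edge = Fin (length pairs)

  Joins : Edge → Vertex s → Vertex s → Set
  Joins e u w =
    (u ≡ inj₁ (j (proj₁ (lookup pairs e))) × w ≡ inj₂ (k (proj₂ (lookup pairs e))))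
    ⊎ (u ≡ inj₂ (k (proj₂ (lookup pairs e))) × w ≡ inj₁ (j (proj₁ (lookup pairs e))))

  record Cycle : Set where
    field
      len      : ℕ
      len≥2    : 2 ≤ len
      vtx      : Fin (suc len) → Vertex s
      edge     : Fin len → Edge
      closed   : vtx zero ≡ vtx (fromℕ len)
      vtxDist  : Injective _≡_ _≡_ (λ (i : Fin len) → vtx (inject₁ i))
      edgeDist : Injective _≡_ _≡_ edge
      joins    : (i : Fin len) → Joins (edge i) (vtx (inject₁ i)) (vtx (suc i))

  open Cycle

  EdgeDisjoint : Cycle → Cycle → Set
  EdgeDisjoint C D = ∀ i i' → ¬ (edge C i ≡ edge D i')

  CommonVertex : Cycle → Cycle → Set
  CommonVertex C D = Σ (Fin (suc (len C))) λ i → Σ (Fin (suc (len D))) λ i' →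
                     vtx C i ≡ vtx D i'

-- Take a pair (x , x') of labels of a common colour, so that the queries for x
-- and x' first probe the same cell.  Whatever that cell holds, one of the two
-- queries ends at an endpoint of the edge { A₀[j x] , A₁[k x'] } of G_Φ, so on
-- every stored string some endpoint of every edge carries the answer to the
-- query of its own label.
--
-- Let C and D be edge-disjoint cycles through a vertex w, where w is the head
-- of the edge r₀ of C and the tail of the edge s₀ of D.  Store the set S of the
-- head labels of all edges of C except r₀, of all edges of D, and the tail
-- label of s₀; it has at most |C| + |D| elements, and since the labels of
-- distinct edges are distinct, no other label lies in S.  Going round C from w,
-- each edge other than r₀ carries a 1 from its tail to its head, while r₀,
-- neither of whose labels is in S, cannot have both endpoints 1: hence w
-- holds 0.  Going round D from w, the edge s₀, both of whose labels are in S,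
-- puts a 1 on one of its endpoints and every other edge carries it onwards:
-- hence w holds 1.

module Submission where

open import Defs
open import Data.Bool using (Bool; true; false; not; if_then_else_; _xor_)
open import Data.Bool.Properties using (¬-not; not-¬)
open import Data.Empty using (⊥-elim)
open import Data.Fin using (Fin; zero; suc; inject₁; fromℕ; _≟_)
open import Data.Fin.Properties using (suc-injective)
open import Data.Fin.Relation.Unary.Top using (view; ‵fromℕ; ‵inject₁)
open import Data.Fin.Subset using (Subset; ∣_∣; ⁅_⁆; _∪_; inside; outside)
  renaming (_∈_ to _∈ₛ_; ⊥ to ∅)
open import Data.Fin.Subset.Properties
  using (∣p∣≤∣x∷p∣; ∣⊥∣≡0; ∣⁅x⁆∣≡1; x∈⁅x⁆; x∈⁅y⁆⇒x≡y; x∈p∪q⁺; x∈p∪q⁻; ∉⊥)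
open import Data.List using (List; []; _∷_; _++_; map; filter; allFin; length; lookup)
open import Data.List.Properties using (filter-notAll; length-++; length-map; length-tabulate)
open import Data.List.Membership.Propositional using (_∈_; _∉_)
open import Data.List.Membership.Propositional.Properties
  using (∈-map⁺; ∈-map⁻; ∈-++⁺ˡ; ∈-++⁺ʳ; ∈-++⁻; ∈-filter⁺; ∈-filter⁻; ∈-allFin; ∈-lookup)
import Data.List.Relation.Unary.All as All
open import Data.List.Relation.Unary.AllPairs using (_∷_)
open import Data.List.Relation.Unary.Any as Any using (here; there)
open import Data.List.Relation.Unary.Unique.Propositional using (Unique)
open import Data.Nat using (ℕ; zero; suc; _+_; _*_; _≤_; z≤n; s≤s)
open import Data.Nat.Properties
  using (≤-trans; ≤-reflexive; +-suc; +-monoʳ-≤; +-monoˡ-≤; +-mono-≤; +-identityʳ; n≤1+n;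
         module ≤-Reasoning)
open import Data.Product using (Σ; _×_; _,_; proj₁; proj₂)
open import Data.Sum using (_⊎_; inj₁; inj₂; swap)
open import Data.Vec using ([]; _∷_)
open import Function using (_∘_; id)
open import Relation.Binary.PropositionalEquality
open import Relation.Nullary using (¬_; ¬?; contradiction)

∣p∪q∣≤∣p∣+∣q∣ : ∀ {n} (p q : Subset n) → ∣ p ∪ q ∣ ≤ ∣ p ∣ + ∣ q ∣
∣p∪q∣≤∣p∣+∣q∣ [] [] = z≤n
∣p∪q∣≤∣p∣+∣q∣ (outside ∷ p) (outside ∷ q) = ∣p∪q∣≤∣p∣+∣q∣ p q
∣p∪q∣≤∣p∣+∣q∣ (outside ∷ p) (inside ∷ q) =
  ≤-trans (s≤s (∣p∪q∣≤∣p∣+∣q∣ p q)) (≤-reflexive (sym (+-suc ∣ p ∣ ∣ q ∣)))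
∣p∪q∣≤∣p∣+∣q∣ (inside ∷ p) (b ∷ q) =
  s≤s (≤-trans (∣p∪q∣≤∣p∣+∣q∣ p q) (+-monoʳ-≤ ∣ p ∣ (∣p∣≤∣x∷p∣ b q)))

fromList : ∀ {n} → List (Fin n) → Subset n
fromList [] = ∅
fromList (x ∷ xs) = ⁅ x ⁆ ∪ fromList xs

∣fromList∣≤length : ∀ {n} (xs : List (Fin n)) → ∣ fromList xs ∣ ≤ length xs
∣fromList∣≤length {n} [] = ≤-reflexive (∣⊥∣≡0 n)
∣fromList∣≤length (x ∷ xs) = begin
  ∣ ⁅ x ⁆ ∪ fromList xs ∣     ≤⟨ ∣p∪q∣≤∣p∣+∣q∣ ⁅ x ⁆ (fromList xs) ⟩
  ∣ ⁅ x ⁆ ∣ + ∣ fromList xs ∣  ≡⟨ cong (_+ ∣ fromList xs ∣) (∣⁅x⁆∣≡1 x) ⟩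
  suc ∣ fromList xs ∣         ≤⟨ s≤s (∣fromList∣≤length xs) ⟩
  suc (length xs)             ∎
  where open ≤-Reasoning

∈⇒∈fromList : ∀ {n} {x : Fin n} {xs} → x ∈ xs → x ∈ₛ fromList xs
∈⇒∈fromList {xs = y ∷ xs} (here refl) = x∈p∪q⁺ {p = ⁅ y ⁆} {q = fromList xs} (inj₁ (x∈⁅x⁆ y))
∈⇒∈fromList {xs = y ∷ xs} (there x∈xs) =
  x∈p∪q⁺ {p = ⁅ y ⁆} {q = fromList xs} (inj₂ (∈⇒∈fromList x∈xs))

∈fromList⇒∈ : ∀ {n} {x : Fin n} xs → x ∈ₛ fromList xs → x ∈ xs
∈fromList⇒∈ [] x∈∅ = ⊥-elim (∉⊥ x∈∅)
∈fromList⇒∈ (y ∷ xs) x∈ with x∈p∪q⁻ ⁅ y ⁆ (fromList xs) x∈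
... | inj₁ x∈⁅y⁆ = here (x∈⁅y⁆⇒x≡y y x∈⁅y⁆)
... | inj₂ x∈xs = there (∈fromList⇒∈ xs x∈xs)

xor-cancelʳ : ∀ {a b} c → a xor c ≡ b xor c → a ≡ b
xor-cancelʳ {false} {false} c _ = refl
xor-cancelʳ {true} {true} c _ = refl
xor-cancelʳ {false} {true} c eq = ⊥-elim (not-¬ refl eq)
xor-cancelʳ {true} {false} c eq = ⊥-elim (not-¬ refl (sym eq))

component : ∀ {A : Set} → A × A → Bool → A
component p false = proj₁ p
component p true = proj₂ p

component∈flatten : ∀ {m} (ps : List (Fin m × Fin m)) (e : Fin (length ps)) b →
                    component (lookup ps e) b ∈ flatten ps
component∈flatten (p ∷ ps) zero false = here refl
component∈flatten (p ∷ ps) zero true = there (here refl)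
component∈flatten (p ∷ ps) (suc e) b = there (there (component∈flatten ps e b))

lookup-component-injective : ∀ {m} (ps : List (Fin m × Fin m)) → Unique (flatten ps) →
  ∀ e e' b b' → component (lookup ps e) b ≡ component (lookup ps e') b' → e ≡ e' × b ≡ b'
lookup-component-injective (p ∷ ps) (u₁ ∷ u₂ ∷ u) = go
  where
  go : ∀ e e' b b' → component (lookup (p ∷ ps) e) b ≡ component (lookup (p ∷ ps) e') b' →
       e ≡ e' × b ≡ b'
  go zero zero false false _ = refl , refl
  go zero zero true true _ = refl , refl
  go zero zero false true eq = ⊥-elim (All.head u₁ eq)
  go zero zero true false eq = ⊥-elim (All.head u₁ (sym eq))
  go zero (suc e') false b' eq = ⊥-elim (All.lookup (All.tail u₁) (component∈flatten ps e' b') eq)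
  go zero (suc e') true b' eq = ⊥-elim (All.lookup u₂ (component∈flatten ps e' b') eq)
  go (suc e) zero b false eq = ⊥-elim (All.lookup (All.tail u₁) (component∈flatten ps e b) (sym eq))
  go (suc e) zero b true eq = ⊥-elim (All.lookup u₂ (component∈flatten ps e b) (sym eq))
  go (suc e) (suc e') b b' eq with lookup-component-injective ps u e e' b b' eq
  ... | e≡e' , b≡b' = cong suc e≡e' , b≡b'

TrueStep : ∀ {n} → (Fin (suc n) → Bool) → Fin n → Set
TrueStep g r = g (inject₁ r) ≡ true → g (suc r) ≡ true

true-reaches-last : ∀ {n} (g : Fin (suc n) → Bool) → (∀ r → TrueStep g r) →
                    g zero ≡ true → g (fromℕ n) ≡ true
true-reaches-last {zero} g steps g₀ = g₀
true-reaches-last {suc n} g steps g₀ =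
  true-reaches-last (λ i → g (suc i)) (λ r → steps (suc r)) (steps zero g₀)

true-reaches-before : ∀ {n} (g : Fin (suc n) → Bool) (r₀ : Fin n) →
  (∀ r → r ≢ r₀ → TrueStep g r) → g zero ≡ true → g (inject₁ r₀) ≡ true
true-reaches-before g zero steps g₀ = g₀
true-reaches-before g (suc r₀) steps g₀ =
  true-reaches-before (λ i → g (suc i)) r₀ (λ r r≢r₀ → steps (suc r) (r≢r₀ ∘ suc-injective))
    (steps zero (λ ()) g₀)

true-reaches-last-after : ∀ {n} (g : Fin (suc n) → Bool) (r₀ : Fin n) →
  (∀ r → r ≢ r₀ → TrueStep g r) → g (suc r₀) ≡ true → g (fromℕ n) ≡ true
true-reaches-last-after g zero steps g₁ =
  true-reaches-last (λ i → g (suc i)) (λ r → steps (suc r) (λ ())) g₁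
true-reaches-last-after g (suc r₀) steps g₁ =
  true-reaches-last-after (λ i → g (suc i)) r₀ (λ r r≢r₀ → steps (suc r) (r≢r₀ ∘ suc-injective)) g₁

closed-walk-true-around : ∀ {n} (g : Fin (suc n) → Bool) → g zero ≡ g (fromℕ n) → (r₀ : Fin n) →
  (∀ r → r ≢ r₀ → TrueStep g r) → g (suc r₀) ≡ true → g (inject₁ r₀) ≡ true
closed-walk-true-around g closed r₀ steps g₁ =
  true-reaches-before g r₀ steps (trans closed (true-reaches-last-after g r₀ steps g₁))

closed-walk-head-false : ∀ {n} (g : Fin (suc n) → Bool) → g zero ≡ g (fromℕ n) → (r₀ : Fin n) →
  (∀ r → r ≢ r₀ → TrueStep g r) → ¬ (g (inject₁ r₀) ≡ true × g (suc r₀) ≡ true) →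
  g (suc r₀) ≡ false
closed-walk-head-false g closed r₀ steps notBoth =
  ¬-not λ g₁ → notBoth (closed-walk-true-around g closed r₀ steps g₁ , g₁)

closed-walk-tail-true : ∀ {n} (g : Fin (suc n) → Bool) → g zero ≡ g (fromℕ n) → (r₀ : Fin n) →
  (∀ r → r ≢ r₀ → TrueStep g r) → g (inject₁ r₀) ≡ true ⊎ g (suc r₀) ≡ true →
  g (inject₁ r₀) ≡ true
closed-walk-tail-true g closed r₀ steps (inj₁ g₀) = g₀
closed-walk-tail-true g closed r₀ steps (inj₂ g₁) = closed-walk-true-around g closed r₀ steps g₁

is-head : ∀ {A : Set} {n} → 1 ≤ n → (v : Fin (suc n) → A) → v zero ≡ v (fromℕ n) →
          ∀ i → Σ (Fin n) λ r → v (suc r) ≡ v i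
is-head {n = suc n} _ v closed zero = fromℕ n , sym closed
is-head {n = suc n} _ v closed (suc r) = r , refl

is-tail : ∀ {A : Set} {n} → 1 ≤ n → (v : Fin (suc n) → A) → v zero ≡ v (fromℕ n) →
          ∀ i → Σ (Fin n) λ r → v (inject₁ r) ≡ v i
is-tail {n = suc n} _ v closed i with view i
... | ‵fromℕ = zero , closed
... | ‵inject₁ r = r , refl

module _ {m n s : ℕ} {Φ : SystematicScheme m n s} (P : Pairing Φ) where
  open SystematicScheme Φ
  open Pairing P

  stored : (xs : List (Fin m)) → length xs ≤ n → Fin s → Bool
  stored xs xs≤n = φ (fromList xs) (≤-trans (∣fromList∣≤length xs) xs≤n)

  query-stored-∈ : ∀ {x} xs (xs≤n : length xs ≤ n) → x ∈ xs → query x (stored xs xs≤n) ≡ true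
  query-stored-∈ xs xs≤n x∈xs = proj₂ (correct _ _ _) (∈⇒∈fromList x∈xs)

  query-stored-∉ : ∀ {x} xs (xs≤n : length xs ≤ n) → x ∉ xs → query x (stored xs xs≤n) ≡ false
  query-stored-∉ xs xs≤n x∉xs = ¬-not (x∉xs ∘ ∈fromList⇒∈ xs ∘ proj₁ (correct _ _ _))

  label : Edge P → Bool → Fin m
  label e = component (lookup pairs e)

  label-injective : ∀ e e' b b' → label e b ≡ label e' b' → e ≡ e' × b ≡ b'
  label-injective = lookup-component-injective pairs disjoint

  cell : Vertex s → Fin s
  cell (inj₁ i) = i
  cell (inj₂ i) = i

  tailComponent : ∀ {e u w} → Joins P e u w → Bool
  tailComponent (inj₁ _) = false
  tailComponent (inj₂ _) = true

  query-when : ∀ (t : Fin s → Bool) x {b} → t (c x) ≡ b →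
               query x t ≡ (if b then t (k x) else t (j x))
  query-when t x = cong (λ b → if b then t (k x) else t (j x))

  pair-answers : (t : Fin s → Bool) (e : Edge P) →
    t (j (label e false)) ≡ query (label e false) t ⊎ t (k (label e true)) ≡ query (label e true) t
  pair-answers t e = answers (t (c (label e false))) refl
    where
    answers : ∀ b → t (c (label e false)) ≡ b →
      t (j (label e false)) ≡ query (label e false) t ⊎ t (k (label e true)) ≡ query (label e true) t
    answers false probe = inj₁ (sym (query-when t _ probe))
    answers true probe =
      inj₂ (sym (query-when t _ (trans (cong t (sym (sameColour (∈-lookup e)))) probe)))

  endpoint-answers : (t : Fin s → Bool) {e : Edge P} {u w : Vertex s} (J : Joins P e u w) →
    t (cell u) ≡ query (label e (tailComponent J)) t ⊎
    t (cell w) ≡ query (label e (not (tailComponent J))) t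
  endpoint-answers t {e} (inj₁ (refl , refl)) = pair-answers t e
  endpoint-answers t {e} (inj₂ (refl , refl)) = swap (pair-answers t e)

  endLabel : (C : Cycle P) → Bool → Fin (Cycle.len C) → Fin m
  endLabel C atHead r = label (Cycle.edge C r) (atHead xor tailComponent (Cycle.joins C r))

  tailLabel headLabel : (C : Cycle P) → Fin (Cycle.len C) → Fin m
  tailLabel C = endLabel C false
  headLabel C = endLabel C true

  endLabel-injective : ∀ (C D : Cycle P) r r' h h' → endLabel C h r ≡ endLabel D h' r' →
    Cycle.edge C r ≡ Cycle.edge D r' ×
    h xor tailComponent (Cycle.joins C r) ≡ h' xor tailComponent (Cycle.joins D r')
  endLabel-injective C D r r' h h' = label-injective _ _ (h xor _) (h' xor _)

  cycle-endLabel-injective : ∀ (C : Cycle P) r r' h h' → endLabel C h r ≡ endLabel C h' r' →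
                             r ≡ r' × h ≡ h'
  cycle-endLabel-injective C r r' h h' eq with endLabel-injective C C r r' h h' eq
  ... | edge≡ , side≡ with Cycle.edgeDist C edge≡
  ...   | refl = refl , xor-cancelʳ _ side≡

  module _ (t : Fin s → Bool) (C : Cycle P) where
    open Cycle C

    bitAt : Fin (suc len) → Bool
    bitAt i = t (cell (vtx i))

    carries-true : ∀ {r} → query (tailLabel C r) t ≡ false → query (headLabel C r) t ≡ true →
                   TrueStep bitAt r
    carries-true {r} no yes tail₁ with endpoint-answers t (joins r)
    ... | inj₁ tail≡ = contradiction (trans (sym tail₁) (trans tail≡ no)) λ ()
    ... | inj₂ head≡ = trans head≡ yes

    blocked-step : ∀ {r} → query (tailLabel C r) t ≡ false → query (headLabel C r) t ≡ false →
                   ¬ (bitAt (inject₁ r) ≡ true × bitAt (suc r) ≡ true)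
    blocked-step {r} noₜ noₕ (tail₁ , head₁) with endpoint-answers t (joins r)
    ... | inj₁ tail≡ = contradiction (trans (sym tail₁) (trans tail≡ noₜ)) λ ()
    ... | inj₂ head≡ = contradiction (trans (sym head₁) (trans head≡ noₕ)) λ ()

    open-step : ∀ {r} → query (tailLabel C r) t ≡ true → query (headLabel C r) t ≡ true →
                bitAt (inject₁ r) ≡ true ⊎ bitAt (suc r) ≡ true
    open-step {r} yesₜ yesₕ with endpoint-answers t (joins r)
    ... | inj₁ tail≡ = inj₁ (trans tail≡ yesₜ)
    ... | inj₂ head≡ = inj₂ (trans head≡ yesₕ)

    bitAt-closed : bitAt zero ≡ bitAt (fromℕ len)
    bitAt-closed = cong (t ∘ cell) closed

  module YesLabels (C D : Cycle P) (disjoint-cycles : EdgeDisjoint P C D)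
                   (r₀ : Fin (Cycle.len C)) (s₀ : Fin (Cycle.len D)) where
    private
      module C = Cycle C
      module D = Cycle D

    others : List (Fin C.len)
    others = filter (λ r → ¬? (r ≟ r₀)) (allFin C.len)

    yesLabels : List (Fin m)
    yesLabels = map (headLabel C) others ++ tailLabel D s₀ ∷ map (headLabel D) (allFin D.len)

    length-yesLabels : length yesLabels ≤ C.len + D.len
    length-yesLabels = begin
      length yesLabels                    ≡⟨ length-++ (map (headLabel C) others) ⟩
      length (map (headLabel C) others) + suc (length (map (headLabel D) (allFin D.len)))
        ≡⟨ cong₂ (λ a b → a + suc b) (length-map (headLabel C) others)
                 (trans (length-map (headLabel D) (allFin D.len)) (length-tabulate id)) ⟩
      length others + suc D.len           ≡⟨ +-suc (length others) D.len ⟩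
      suc (length others) + D.len         ≤⟨ +-monoˡ-≤ D.len others<len ⟩
      C.len + D.len                       ∎
      where
      open ≤-Reasoning
      others<len : suc (length others) ≤ C.len
      others<len = subst (suc (length others) ≤_) (length-tabulate id)
        (filter-notAll _ (allFin C.len) (Any.map (λ { refl r₀≢r₀ → r₀≢r₀ refl }) (∈-allFin r₀)))

    headC∈ : ∀ r → r ≢ r₀ → headLabel C r ∈ yesLabels
    headC∈ r r≢r₀ = ∈-++⁺ˡ (∈-map⁺ (headLabel C) (∈-filter⁺ _ (∈-allFin r) r≢r₀))

    tailD₀∈ : tailLabel D s₀ ∈ yesLabels
    tailD₀∈ = ∈-++⁺ʳ _ (here refl)

    headD∈ : ∀ s → headLabel D s ∈ yesLabels
    headD∈ s = ∈-++⁺ʳ _ (there (∈-map⁺ (headLabel D) (∈-allFin s)))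

    data YesLabel (x : Fin m) : Set where
      headC : ∀ r → r ≢ r₀ → x ≡ headLabel C r → YesLabel x
      tailD₀ : x ≡ tailLabel D s₀ → YesLabel x
      headD : ∀ s → x ≡ headLabel D s → YesLabel x

    yesLabel : ∀ {x} → x ∈ yesLabels → YesLabel x
    yesLabel x∈ with ∈-++⁻ (map (headLabel C) others) x∈
    ... | inj₁ x∈C with ∈-map⁻ (headLabel C) x∈C
    ...   | r , r∈others , x≡ = headC r (proj₂ (∈-filter⁻ _ {xs = allFin C.len} r∈others)) x≡
    yesLabel x∈ | inj₂ (here x≡) = tailD₀ x≡
    yesLabel x∈ | inj₂ (there x∈D) with ∈-map⁻ (headLabel D) x∈D
    ... | s , _ , x≡ = headD s x≡

    private
      C-D-labels-differ : ∀ r s h h' → endLabel C h r ≢ endLabel D h' s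
      C-D-labels-differ r s h h' eq =
        disjoint-cycles r s (proj₁ (endLabel-injective C D r s h h' eq))

    tailC∉ : ∀ r → tailLabel C r ∉ yesLabels
    tailC∉ r x∈ with yesLabel x∈
    ... | headC r' _ eq with cycle-endLabel-injective C r r' false true eq
    ...   | _ , ()
    tailC∉ r x∈ | tailD₀ eq = C-D-labels-differ r s₀ false false eq
    tailC∉ r x∈ | headD s eq = C-D-labels-differ r s false true eq

    headC₀∉ : headLabel C r₀ ∉ yesLabels
    headC₀∉ x∈ with yesLabel x∈
    ... | headC r r≢r₀ eq = r≢r₀ (sym (proj₁ (cycle-endLabel-injective C r₀ r true true eq)))
    ... | tailD₀ eq = C-D-labels-differ r₀ s₀ true false eq
    ... | headD s eq = C-D-labels-differ r₀ s true true eq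

    tailD∉ : ∀ s → s ≢ s₀ → tailLabel D s ∉ yesLabels
    tailD∉ s s≢s₀ x∈ with yesLabel x∈
    ... | headC r _ eq = C-D-labels-differ r s true false (sym eq)
    ... | tailD₀ eq = s≢s₀ (proj₁ (cycle-endLabel-injective D s s₀ false false eq))
    ... | headD s' eq with cycle-endLabel-injective D s s' false true eq
    ...   | _ , ()

  short-cycles-through-common-vertex : (C D : Cycle P) → Cycle.len C + Cycle.len D ≤ n →
    EdgeDisjoint P C D → ¬ CommonVertex P C D
  short-cycles-through-common-vertex C D bound disjoint-cycles (i , i' , vC≡vD) =
    contradiction (trans (sym w-in-C) w-in-D) λ ()
    where
    module C = Cycle C
    module D = Cycle D

    C-enters-w : Σ (Fin C.len) λ r → C.vtx (suc r) ≡ C.vtx i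
    C-enters-w = is-head (≤-trans (n≤1+n 1) C.len≥2) C.vtx C.closed i
    D-leaves-w : Σ (Fin D.len) λ r → D.vtx (inject₁ r) ≡ D.vtx i'
    D-leaves-w = is-tail (≤-trans (n≤1+n 1) D.len≥2) D.vtx D.closed i'

    r₀ : Fin C.len
    r₀ = proj₁ C-enters-w
    s₀ : Fin D.len
    s₀ = proj₁ D-leaves-w

    open YesLabels C D disjoint-cycles r₀ s₀

    t : Fin s → Bool
    t = stored yesLabels (≤-trans length-yesLabels bound)

    yes : ∀ {x} → x ∈ yesLabels → query x t ≡ true
    yes = query-stored-∈ yesLabels _
    no : ∀ {x} → x ∉ yesLabels → query x t ≡ false
    no = query-stored-∉ yesLabels _

    head₀-false : bitAt t C (suc r₀) ≡ false
    head₀-false = closed-walk-head-false (bitAt t C) (bitAt-closed t C) r₀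
      (λ r r≢r₀ → carries-true t C (no (tailC∉ r)) (yes (headC∈ r r≢r₀)))
      (blocked-step t C (no (tailC∉ r₀)) (no headC₀∉))

    tail₀-true : bitAt t D (inject₁ s₀) ≡ true
    tail₀-true = closed-walk-tail-true (bitAt t D) (bitAt-closed t D) s₀
      (λ s s≢s₀ → carries-true t D (no (tailD∉ s s≢s₀)) (yes (headD∈ s)))
      (open-step t D (yes tailD₀∈) (yes (headD∈ s₀)))

    w-in-C : t (cell (C.vtx i)) ≡ false
    w-in-C = trans (cong (t ∘ cell) (sym (proj₂ C-enters-w))) head₀-false

    w-in-D : t (cell (C.vtx i)) ≡ true
    w-in-D = trans (cong (t ∘ cell) (trans vC≡vD (sym (proj₂ D-leaves-w)))) tail₀-true

corollary1 : {m s : ℕ} (k : ℕ) → 1 ≤ k → (Φ : SystematicScheme m (2 * k) s) → (P : Pairing Φ) →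
    ¬ (Σ (Cycle P) λ C → Σ (Cycle P) λ D →
    Cycle.len C ≤ k × Cycle.len D ≤ k × EdgeDisjoint P C D × CommonVertex P C D)
corollary1 k _ Φ P (C , D , |C|≤k , |D|≤k , disjoint-cycles , meet) =
  short-cycles-through-common-vertex P C D |C|+|D|≤2k disjoint-cycles meet
  where
  |C|+|D|≤2k : Cycle.len C + Cycle.len D ≤ 2 * k
  |C|+|D|≤2k = subst (Cycle.len C + Cycle.len D ≤_) (cong (k +_) (sym (+-identityʳ k)))
    (+-mono-≤ |C|≤k |D|≤k)
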